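{- Let $\varphi:MS_n\to S_n(231,312,321)$ send a Morse sequence $\mu=m_1m_2\dots m_k$ of length $n$ to the layered matching $\pi$ of $[n]$ with $k$ layers whose $i$-th layer is a singleton if $m_i$ is a dot and a doubleton if $m_i$ is a dash. Then for every $\mu\in MS_n$, $w(\mu)=maj(\varphi(\mu))$.
   Context: A Morse sequence of length $n$ is a finite sequence of dots (each of length $1$) and dashes (each of length $2$) with total length $n$; $MS_n$ is the set of them. For a dash, let $a$ be the total length of the part of the sequence preceding it; the weight of the dash is $a+1$, dots have weight $0$, and $w(\mu)$ is the sum of the weights of the dashes of $\mu$. A layered matching of $[n]$ is a permutation $\pi_1\pi_2\dots\pi_k$ (concatenation) where each layer $\pi_i$ is a decreasing sequence of length $1$ (singleton) or $2$ (doubleton) and $\max\pi_i<\min\pi_j$ for $i<j$; these are exactly the elements of $S_n(231,312,321)$, the permutations of $[n]$ avoiding $231$, $312$, $321$. For $\pi=p_1\dots p_n$, $maj(\pi)=\sum_{i:\,p_i>p_{i+1}}i$. -}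

module Defs where

open import Data.Nat using (ℕ; zero; suc; _+_; _<ᵇ_)
open import Data.List using (List; []; _∷_; _++_)
open import Data.Bool using (if_then_else_)
open import Relation.Binary.PropositionalEquality using (_≡_)

data Morse : Set where
  dot dash : Morse

len : Morse → ℕ
len dot  = 1
len dash = 2

totalLen : List Morse → ℕ
totalLen []       = 0
totalLen (m ∷ ms) = len m + totalLen ms

record MS (n : ℕ) : Set where
  constructor mkMS
  field
    seq    : List Morse
    hasLen : totalLen seq ≡ n

-- weight of a sequence, where a is the total length of the part preceding it:
-- a dash preceded by total length a has weight a + 1, dots weight 0
weightFrom : ℕ → List Morse → ℕ
weightFrom a []          = 0
weightFrom a (dot  ∷ ms) = weightFrom (a + 1) ms
weightFrom a (dash ∷ ms) = (a + 1) + weightFrom (a + 2) ms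

w : List Morse → ℕ
w = weightFrom 0

-- layered matching (one-line notation, values in 1..n) whose layers are
-- determined by the Morse symbols; a = number of entries already used.
-- dot  ↦ singleton layer  (a+1)
-- dash ↦ doubleton layer  (a+2)(a+1)  (decreasing)
φFrom : ℕ → List Morse → List ℕ
φFrom a []          = []
φFrom a (dot  ∷ ms) = suc a ∷ φFrom (a + 1) ms
φFrom a (dash ∷ ms) = suc (suc a) ∷ suc a ∷ φFrom (a + 2) ms

φ : List Morse → List ℕ
φ = φFrom 0

-- maj(π) = Σ_{i : p_i > p_{i+1}} i, positions 1-indexed;
-- majFrom i computes the sum when the head is at position i.
majFrom : ℕ → List ℕ → ℕ
majFrom i []           = 0
majFrom i (p ∷ [])     = 0
majFrom i (p ∷ q ∷ ps) =
  (if q <ᵇ p then i else 0) + majFrom (suc i) (q ∷ ps)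

maj : List ℕ → ℕ
maj = majFrom 1

-- Along φ(μ) the entries only descend inside a doubleton layer: every layer
-- lies entirely above the earlier ones. A dash preceded by total length a
-- occupies positions a + 1 and a + 2 of φ(μ) with values a + 2 and a + 1, so it
-- contributes exactly one descent, at position a + 1, which is its weight.
module Submission where

open import Defs
open import Data.Bool using (T; true; false)
open import Data.Bool.Properties using (T-≡)
open import Data.List using ([]; _∷_)
open import Data.Nat using (ℕ; suc; _+_; _≤_; _<_; _<ᵇ_)
open import Data.Nat.Properties using (+-comm; <ᵇ⇒<; <⇒<ᵇ; ≤⇒≯; n≤1+n; m≤n⇒m≤1+n; n<1+n)
open import Function.Bundles using (Equivalence)
open import Relation.Binary.PropositionalEquality using (_≡_; refl; cong; sym; subst; module ≡-Reasoning)
open import Relation.Nullary using (contradiction)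
open ≡-Reasoning

majFrom-ascent : ∀ i p q ps → p ≤ q →
                 majFrom i (p ∷ q ∷ ps) ≡ majFrom (suc i) (q ∷ ps)
majFrom-ascent i p q ps p≤q with q <ᵇ p in q<ᵇp
... | false = refl
... | true  = contradiction (<ᵇ⇒< q p (subst T (sym q<ᵇp) _)) (≤⇒≯ p≤q)

majFrom-descent : ∀ i p q ps → q < p →
                  majFrom i (p ∷ q ∷ ps) ≡ i + majFrom (suc i) (q ∷ ps)
majFrom-descent i p q ps q<p rewrite Equivalence.to T-≡ (<⇒<ᵇ q<p) = refl

majFrom-below-φFrom : ∀ i {p} a ms → p ≤ suc a →
                      majFrom i (p ∷ φFrom a ms) ≡ majFrom (suc i) (φFrom a ms)
majFrom-below-φFrom i a []          p≤ = refl
majFrom-below-φFrom i a (dot  ∷ ms) p≤ = majFrom-ascent i _ _ (φFrom (a + 1) ms) p≤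
majFrom-below-φFrom i a (dash ∷ ms) p≤ =
  majFrom-ascent i _ _ (suc a ∷ φFrom (a + 2) ms) (m≤n⇒m≤1+n p≤)

weightFrom≡majFrom-φFrom : ∀ a ms → weightFrom a ms ≡ majFrom (suc a) (φFrom a ms)
weightFrom≡majFrom-φFrom a [] = refl
weightFrom≡majFrom-φFrom a (dot ∷ ms) rewrite +-comm a 1 = begin
  weightFrom (suc a) ms                       ≡⟨ weightFrom≡majFrom-φFrom (suc a) ms ⟩
  majFrom (suc (suc a)) (φFrom (suc a) ms)    ≡⟨ majFrom-below-φFrom (suc a) (suc a) ms (n≤1+n _) ⟨
  majFrom (suc a) (suc a ∷ φFrom (suc a) ms)  ∎
weightFrom≡majFrom-φFrom a (dash ∷ ms) rewrite +-comm a 1 | +-comm a 2 = begin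
  suc a + weightFrom a₂ ms                    ≡⟨ cong (suc a +_) (weightFrom≡majFrom-φFrom a₂ ms) ⟩
  suc a + majFrom (suc a₂) (φFrom a₂ ms)      ≡⟨ cong (suc a +_) (majFrom-below-φFrom a₂ a₂ ms (m≤n⇒m≤1+n (n≤1+n _))) ⟨
  suc a + majFrom a₂ (suc a ∷ φFrom a₂ ms)    ≡⟨ majFrom-descent (suc a) a₂ (suc a) (φFrom a₂ ms) (n<1+n (suc a)) ⟨
  majFrom (suc a) (a₂ ∷ suc a ∷ φFrom a₂ ms)  ∎
  where
  a₂ : ℕ
  a₂ = suc (suc a)

lemma3p2 : (n : ℕ) (μ : MS n) → w (MS.seq μ) ≡ maj (φ (MS.seq μ))
lemma3p2 n μ = weightFrom≡majFrom-φFrom 0 (MS.seq μ)
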